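{- Let $w_1,w_2,w_3$ be positive integers and $n\ge0$ an integer. Then \begin{align*} &\sum_{k+l+m=n}\binom{n}{k,l,m}S_{k,q^{w_3}}(w_1-1)S_{l,q^{w_1}}(w_2-1)S_{m,q^{w_2}}(w_3-1)\,w_3^{k-1}w_1^{l-1}w_2^{m-1}\\ &=\sum_{k+l+m=n}\binom{n}{k,l,m}S_{k,q^{w_2}}(w_1-1)S_{l,q^{w_1}}(w_3-1)S_{m,q^{w_3}}(w_2-1)\,w_2^{k-1}w_1^{l-1}w_3^{m-1}. \end{align*}
   Context: Let $p$ be a prime, $\mathbb{C}_p$ the completion of an algebraic closure of $\mathbb{Q}_p$, and $|\cdot|_p$ the absolute value on $\mathbb{C}_p$ with $|p|_p=1/p$. Fix $q\in\mathbb{C}_p$ with $q\neq 1$ and $|q-1|_p<p^{ -1/(p-1)}$. For $Q\in\mathbb{C}_p$ and integers $k\ge0$, $N\ge0$, the $Q$-analogue of the power sum is $S_{k,Q}(N)=\sum_{i=0}^N i^kQ^i$, with the convention $0^0=1$. The sum $\sum_{k+l+m=n}$ runs over nonnegative integers $k,l,m$ with $k+l+m=n$, and $\binom{n}{k,l,m}=\frac{n!}{k!\,l!\,m!}$. -}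

module Defs where

open import Level using (Level)
open import Data.Nat as ℕ using (ℕ; zero; suc; _∸_; _!; _/_)
open import Data.Nat.Properties using (_!≢0; m*n≢0)
open import Algebra.Bundles using (CommutativeRing)

multinomial : ℕ → ℕ → ℕ → ℕ → ℕ
multinomial n k l m =
  let instance _ = k !≢0 ; _ = l !≢0 ; _ = m !≢0
               _ = m*n≢0 (k !) (l !)
               _ = m*n≢0 (k ! ℕ.* l !) (m !)
  in (n !) / (k ! ℕ.* l ! ℕ.* m !)

module _ {c ℓ : Level} (R : CommutativeRing c ℓ) where
  open CommutativeRing R

  embed : ℕ → Carrier
  embed zero    = 0#
  embed (suc n) = 1# + embed n

  -- powers, with x ^ 0 = 1 (so 0^0 = 1)
  pow : Carrier → ℕ → Carrier
  pow x zero    = 1#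
  pow x (suc n) = x * pow x n

  S : ℕ → Carrier → ℕ → Carrier
  S k Q zero    = pow (embed 0) k * pow Q 0
  S k Q (suc N) = S k Q N + pow (embed (suc N)) k * pow Q (suc N)

  -- w^{k-1} for a positive integer w with given inverse winv of w in R:
  -- w^{-1} = winv when k = 0, and w^{k-1} otherwise
  wpow : ℕ → Carrier → ℕ → Carrier
  wpow w winv zero    = winv
  wpow w winv (suc k) = pow (embed w) k

  -- Σ_{k+l+m=n} f k l m  (k from 0..n, l from 0..n-k, m = n-k-l)
  sumL : ℕ → (ℕ → Carrier) → Carrier
  sumL zero    g = g 0
  sumL (suc j) g = sumL j g + g (suc j)

  sum3 : ℕ → (ℕ → ℕ → ℕ → Carrier) → Carrier
  sum3 n f = sumL n (λ k → sumL (n ∸ k) (λ l → f k l (n ∸ k ∸ l)))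

module Submission where

-- Write a = w₁, b = w₂, c = w₃ and S_{k,Q}(N) = Σ_{i≤N} i^k Q^i.  Absorbing the
-- weights into the power sums (c^k S_{k,q^c}(a-1) = Σ_{i<a} (c i)^k q^{c i}, etc.),
-- exchanging summations and applying the trinomial theorem, the left-hand side
-- becomes (w₃ w₁ w₂)⁻¹ Σ_{i<a, j<b, h<c} f(c i + a j + b h) with f(N) = q^N N^n
-- (powerSum-expansion); the right-hand side is the same with b and c exchanged.
-- It remains to show that such lattice sums are symmetric in b and c for EVERY
-- sequence f (latticeSum-reciprocity).  Writing f = Δ_b Δ_a Δ_c F with forward
-- differences (Δ_d F)(N) = F(N + d) - F(N), summing along the three
-- progressions telescopes the lattice sum to (Δ_{bc} Δ_{ab} Δ_{ca} F)(0), which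
-- is symmetric because difference operators commute.

open import Defs
open import Level using (Level)
open import Data.Nat using (ℕ; _∸_; _>_)
open import Algebra.Bundles using (CommutativeRing)

open import Data.Nat using (zero; suc; _≤_; z≤n; _!; NonZero) renaming (_+_ to _+ℕ_; _*_ to _*ℕ_)
import Data.Nat.Properties as ℕ
open import Data.Nat.Properties using (_!≢0; m*n≢0)
open import Data.Nat.DivMod
  using (_/_; _%_; m/n*n≡m; m*n/n≡m; /-congˡ; m/n≡1+[m∸n]/n; [m+n]%n≡m%n; m≡m%n+[m/n]*n)
open import Data.Nat.Combinatorics using (_C_; nCk≡n!/k![n-k]!; k![n∸k]!∣n!)
open import Data.Nat.Tactic.RingSolver using (solve-∀)
open import Data.Fin using (toℕ)
open import Relation.Binary.PropositionalEquality as ≡ using (_≡_)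
import Relation.Binary.Reasoning.Setoid as SetoidReasoning
import Algebra.Solver.CommutativeMonoid as CommutativeMonoidSolver
import Algebra.Properties.AbelianGroup as AbelianGroupProperties
import Algebra.Properties.CommutativeSemigroup as CommutativeSemigroupProperties
import Algebra.Properties.Semiring.Exp as SemiringExp
import Algebra.Properties.CommutativeSemiring.Exp as CommutativeSemiringExp
import Algebra.Properties.Semiring.Mult as SemiringMult
import Algebra.Properties.Semiring.Sum as SemiringSum
import Algebra.Properties.CommutativeSemiring.Binomial as Binomial

open CommutativeSemigroupProperties ℕ.+-commutativeSemigroup using () renaming (xy∙z≈xz∙y to +-swapʳ)

binomial-times-factorials : ∀ {n k} → k ≤ n → (n C k) *ℕ (k ! *ℕ (n ∸ k) !) ≡ n !
binomial-times-factorials {n} {k} k≤n =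
  ≡.trans (≡.cong (_*ℕ (k ! *ℕ (n ∸ k) !)) (nCk≡n!/k![n-k]! k≤n)) (m/n*n≡m (k![n∸k]!∣n! k≤n))
  where
    instance
      k![n-k]!≢0 : NonZero (k ! *ℕ (n ∸ k) !)
      k![n-k]!≢0 = m*n≢0 (k !) ((n ∸ k) !) {{k !≢0}} {{(n ∸ k) !≢0}}

multinomial≡binomials : ∀ n k l → k ≤ n → l ≤ n ∸ k →
  multinomial n k l (n ∸ k ∸ l) ≡ (n C k) *ℕ ((n ∸ k) C l)
multinomial≡binomials n k l k≤n l≤n-k =
  ≡.trans (/-congˡ n!≡) (m*n/n≡m ((n C k) *ℕ ((n ∸ k) C l)) (k ! *ℕ l ! *ℕ m !))
  where
    m : ℕ
    m = n ∸ k ∸ l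
    instance
      k!≢0 : NonZero (k !)
      k!≢0 = k !≢0
      l!≢0 : NonZero (l !)
      l!≢0 = l !≢0
      m!≢0 : NonZero (m !)
      m!≢0 = m !≢0
      k!l!≢0 : NonZero (k ! *ℕ l !)
      k!l!≢0 = m*n≢0 (k !) (l !)
      k!l!m!≢0 : NonZero (k ! *ℕ l ! *ℕ m !)
      k!l!m!≢0 = m*n≢0 (k ! *ℕ l !) (m !)
    regroup : ∀ a b x y z → a *ℕ (x *ℕ (b *ℕ (y *ℕ z))) ≡ (a *ℕ b) *ℕ (x *ℕ y *ℕ z)
    regroup = solve-∀
    n!≡ : n ! ≡ ((n C k) *ℕ ((n ∸ k) C l)) *ℕ (k ! *ℕ l ! *ℕ m !)
    n!≡ = begin
      n !                                                 ≡⟨ binomial-times-factorials k≤n ⟨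
      (n C k) *ℕ (k ! *ℕ (n ∸ k) !)                      ≡⟨ ≡.cong (λ z → (n C k) *ℕ (k ! *ℕ z))
                                                               (binomial-times-factorials l≤n-k) ⟨
      (n C k) *ℕ (k ! *ℕ (((n ∸ k) C l) *ℕ (l ! *ℕ m !))) ≡⟨ regroup (n C k) ((n ∸ k) C l) (k !) (l !) (m !) ⟩
      ((n C k) *ℕ ((n ∸ k) C l)) *ℕ (k ! *ℕ l ! *ℕ m !)  ∎
      where open ≡.≡-Reasoning

[m+n]/n≡1+m/n : ∀ N d' → (N +ℕ suc d') / suc d' ≡ suc (N / suc d')
[m+n]/n≡1+m/n N d' =
  ≡.trans (m/n≡1+[m∸n]/n (ℕ.m≤n+m (suc d') N)) (≡.cong (λ z → suc (z / suc d')) (ℕ.m+n∸n≡m N (suc d')))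

module _ {r ℓ : Level} (R : CommutativeRing r ℓ) where
  open CommutativeRing R
  open SetoidReasoning setoid
  open AbelianGroupProperties +-abelianGroup using (⁻¹-∙-comm; xyx⁻¹≈y)
  open CommutativeSemigroupProperties +-commutativeSemigroup using (interchange)
  open SemiringExp semiring using (_^_; ^-congˡ; ^-homo-*; ^-assocʳ)
  open CommutativeSemiringExp commutativeSemiring using (^-distrib-*)
  open SemiringMult semiring using (_×_; ×-congʳ; ×-homo-+; ×1-homo-*; ×-assoc-*)
  open SemiringSum semiring using (sum)
  module *-Solver = CommutativeMonoidSolver *-commutativeMonoid

  telescope-step : ∀ x y z → (y - x) + (z - y) ≈ z - x
  telescope-step x y z = begin
    (y - x) + (z - y)     ≈⟨ +-comm _ _ ⟩
    (z + - y) + (y + - x) ≈⟨ +-assoc z (- y) _ ⟩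
    z + (- y + (y + - x)) ≈⟨ +-congˡ (+-assoc (- y) y (- x)) ⟨
    z + ((- y + y) + - x) ≈⟨ +-congˡ (+-congʳ (-‿inverseˡ y)) ⟩
    z + (0# + - x)        ≈⟨ +-congˡ (+-identityˡ (- x)) ⟩
    z - x                 ∎

  sub-interchange : ∀ x y z w → (x - y) - (z - w) ≈ (x - z) - (y - w)
  sub-interchange x y z w = begin
    (x + - y) + - (z + - w)   ≈⟨ +-congˡ (⁻¹-∙-comm z (- w)) ⟨
    (x + - y) + (- z + - - w) ≈⟨ interchange x (- y) (- z) (- - w) ⟩
    (x + - z) + (- y + - - w) ≈⟨ +-congˡ (⁻¹-∙-comm y (- w)) ⟩
    (x + - z) + - (y + - w)   ∎

  sumL-cong≤ : ∀ j {f g : ℕ → Carrier} → (∀ t → t ≤ j → f t ≈ g t) → sumL R j f ≈ sumL R j g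
  sumL-cong≤ zero    f≈g = f≈g 0 z≤n
  sumL-cong≤ (suc j) f≈g = +-cong (sumL-cong≤ j (λ t t≤j → f≈g t (ℕ.m≤n⇒m≤1+n t≤j))) (f≈g (suc j) ℕ.≤-refl)

  sumL-cong : ∀ j {f g : ℕ → Carrier} → (∀ t → f t ≈ g t) → sumL R j f ≈ sumL R j g
  sumL-cong j f≈g = sumL-cong≤ j (λ t _ → f≈g t)

  sumL-+ : ∀ j f g → sumL R j (λ t → f t + g t) ≈ sumL R j f + sumL R j g
  sumL-+ zero    f g = refl
  sumL-+ (suc j) f g = trans (+-congʳ (sumL-+ j f g)) (interchange _ _ _ _)

  sumL-neg : ∀ j f → sumL R j (λ t → - f t) ≈ - sumL R j f
  sumL-neg zero    f = refl
  sumL-neg (suc j) f = trans (+-congʳ (sumL-neg j f)) (⁻¹-∙-comm _ _)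

  sumL-- : ∀ j f g → sumL R j (λ t → f t - g t) ≈ sumL R j f - sumL R j g
  sumL-- j f g = trans (sumL-+ j f (λ t → - g t)) (+-congˡ (sumL-neg j g))

  sumL-*ˡ : ∀ j x f → x * sumL R j f ≈ sumL R j (λ t → x * f t)
  sumL-*ˡ zero    x f = refl
  sumL-*ˡ (suc j) x f = trans (distribˡ x _ _) (+-congʳ (sumL-*ˡ j x f))

  sumL-*ʳ : ∀ j x f → sumL R j f * x ≈ sumL R j (λ t → f t * x)
  sumL-*ʳ zero    x f = refl
  sumL-*ʳ (suc j) x f = trans (distribʳ x _ _) (+-congʳ (sumL-*ʳ j x f))

  sumL-swap : ∀ p r (f : ℕ → ℕ → Carrier) →
    sumL R p (λ x → sumL R r (f x)) ≈ sumL R r (λ y → sumL R p (λ x → f x y))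
  sumL-swap zero    r f = refl
  sumL-swap (suc p) r f = trans (+-congʳ (sumL-swap p r f)) (sym (sumL-+ r _ _))

  sumL-product : ∀ p r f g → sumL R p f * sumL R r g ≈ sumL R p (λ i → sumL R r (λ j → f i * g j))
  sumL-product p r f g = trans (sumL-*ʳ p _ f) (sumL-cong p (λ i → sumL-*ˡ r (f i) g))

  sumL-telescope : ∀ j (u : ℕ → Carrier) → sumL R j (λ t → u (suc t) - u t) ≈ u (suc j) - u 0
  sumL-telescope zero    u = refl
  sumL-telescope (suc j) u = trans (+-congʳ (sumL-telescope j u)) (telescope-step _ _ _)

  sum3-cong≤ : ∀ n {F G : ℕ → ℕ → ℕ → Carrier} →
    (∀ k l → k ≤ n → l ≤ n ∸ k → F k l (n ∸ k ∸ l) ≈ G k l (n ∸ k ∸ l)) → sum3 R n F ≈ sum3 R n G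
  sum3-cong≤ n F≈G = sumL-cong≤ n (λ k k≤n → sumL-cong≤ (n ∸ k) (λ l l≤n-k → F≈G k l k≤n l≤n-k))

  sum3-cong : ∀ n {F G : ℕ → ℕ → ℕ → Carrier} → (∀ k l m → F k l m ≈ G k l m) → sum3 R n F ≈ sum3 R n G
  sum3-cong n {F} {G} F≈G = sum3-cong≤ n {F} {G} (λ k l _ _ → F≈G k l (n ∸ k ∸ l))

  sum3-*ˡ : ∀ n x F → x * sum3 R n F ≈ sum3 R n (λ k l m → x * F k l m)
  sum3-*ˡ n x F = trans (sumL-*ˡ n x _) (sumL-cong n (λ k → sumL-*ˡ (n ∸ k) x _))

  sum3-sumL-swap : ∀ n r (F : ℕ → ℕ → ℕ → ℕ → Carrier) →
    sum3 R n (λ k l m → sumL R r (F k l m)) ≈ sumL R r (λ i → sum3 R n (λ k l m → F k l m i))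
  sum3-sumL-swap n r F = trans (sumL-cong n (λ k → sumL-swap (n ∸ k) r _)) (sumL-swap n r _)

  boxSum : ℕ → ℕ → ℕ → (ℕ → ℕ → ℕ → Carrier) → Carrier
  boxSum a' b' c' g = sumL R a' (λ i → sumL R b' (λ j → sumL R c' (λ h → g i j h)))

  boxSum-cong : ∀ a' b' c' {g g' : ℕ → ℕ → ℕ → Carrier} →
    (∀ i j h → g i j h ≈ g' i j h) → boxSum a' b' c' g ≈ boxSum a' b' c' g'
  boxSum-cong a' b' c' g≈g' = sumL-cong a' (λ i → sumL-cong b' (λ j → sumL-cong c' (g≈g' i j)))

  boxSum-*ˡ : ∀ a' b' c' x g → x * boxSum a' b' c' g ≈ boxSum a' b' c' (λ i j h → x * g i j h)
  boxSum-*ˡ a' b' c' x g =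
    trans (sumL-*ˡ a' x _) (sumL-cong a' (λ i → trans (sumL-*ˡ b' x _) (sumL-cong b' (λ j → sumL-*ˡ c' x _))))

  boxSum-product : ∀ a' b' c' f g h →
    sumL R a' f * sumL R b' g * sumL R c' h ≈ boxSum a' b' c' (λ i j t → f i * g j * h t)
  boxSum-product a' b' c' f g h = begin
    sumL R a' f * sumL R b' g * sumL R c' h                     ≈⟨ *-congʳ (sumL-product a' b' f g) ⟩
    sumL R a' (λ i → sumL R b' (λ j → f i * g j)) * sumL R c' h ≈⟨ sumL-*ʳ a' _ _ ⟩
    sumL R a' (λ i → sumL R b' (λ j → f i * g j) * sumL R c' h) ≈⟨ sumL-cong a' (λ i → sumL-product b' c' _ h) ⟩
    boxSum a' b' c' (λ i j t → f i * g j * h t)                  ∎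

  sum3-boxSum-swap : ∀ n a' b' c' (F : ℕ → ℕ → ℕ → ℕ → ℕ → ℕ → Carrier) →
    sum3 R n (λ k l m → boxSum a' b' c' (F k l m)) ≈ boxSum a' b' c' (λ i j h → sum3 R n (λ k l m → F k l m i j h))
  sum3-boxSum-swap n a' b' c' F =
    trans (sum3-sumL-swap n a' (λ k l m i → sumL R b' (λ j → sumL R c' (F k l m i j))))
          (sumL-cong a' (λ i → trans (sum3-sumL-swap n b' (λ k l m j → sumL R c' (F k l m i j)))
                                     (sumL-cong b' (λ j → sum3-sumL-swap n c' (λ k l m → F k l m i j)))))

  -- The image of ℕ in R and the powers of Defs agree with the library's n × 1#
  -- and x ^ k, so their homomorphism laws are imported from the library.
  embed≡×1# : ∀ n → embed R n ≡ n × 1#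
  embed≡×1# zero    = ≡.refl
  embed≡×1# (suc n) = ≡.cong (1# +_) (embed≡×1# n)

  pow≡^ : ∀ x k → pow R x k ≡ x ^ k
  pow≡^ x zero    = ≡.refl
  pow≡^ x (suc k) = ≡.cong (x *_) (pow≡^ x k)

  embed-+ : ∀ m n → embed R (m +ℕ n) ≈ embed R m + embed R n
  embed-+ m n rewrite embed≡×1# (m +ℕ n) | embed≡×1# m | embed≡×1# n = ×-homo-+ 1# m n

  embed-* : ∀ m n → embed R (m *ℕ n) ≈ embed R m * embed R n
  embed-* m n rewrite embed≡×1# (m *ℕ n) | embed≡×1# m | embed≡×1# n = ×1-homo-* m n

  ×≈embed* : ∀ m x → m × x ≈ embed R m * x
  ×≈embed* m x rewrite embed≡×1# m = sym (trans (×-assoc-* m 1# x) (×-congʳ m (*-identityˡ x)))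

  pow-cong : ∀ {x y} k → x ≈ y → pow R x k ≈ pow R y k
  pow-cong {x} {y} k x≈y rewrite pow≡^ x k | pow≡^ y k = ^-congˡ k x≈y

  pow-+ : ∀ x m n → pow R x (m +ℕ n) ≈ pow R x m * pow R x n
  pow-+ x m n rewrite pow≡^ x (m +ℕ n) | pow≡^ x m | pow≡^ x n = ^-homo-* x m n

  pow-* : ∀ x y k → pow R (x * y) k ≈ pow R x k * pow R y k
  pow-* x y k rewrite pow≡^ (x * y) k | pow≡^ x k | pow≡^ y k = ^-distrib-* x y k

  pow-pow : ∀ x m n → pow R (pow R x m) n ≈ pow R x (m *ℕ n)
  pow-pow x m n rewrite pow≡^ (pow R x m) n | pow≡^ x m | pow≡^ x (m *ℕ n) = ^-assocʳ x m n

  sum≈sumL : ∀ n (g : ℕ → Carrier) → sum {suc n} (λ i → g (toℕ i)) ≈ sumL R n g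
  sum≈sumL zero    g = +-identityʳ (g 0)
  sum≈sumL (suc n) g = begin
    g 0 + sum {suc n} (λ i → g (suc (toℕ i))) ≈⟨ +-congˡ (sum≈sumL n (λ t → g (suc t))) ⟩
    g 0 + sumL R n (λ t → g (suc t))         ≈⟨ shift n ⟩
    sumL R (suc n) g                         ∎
    where
      shift : ∀ j → g 0 + sumL R j (λ t → g (suc t)) ≈ sumL R (suc j) g
      shift zero    = refl
      shift (suc j) = trans (sym (+-assoc _ _ _)) (+-congʳ (shift j))

  binomial : ∀ n x y → pow R (x + y) n ≈ sumL R n (λ k → embed R (n C k) * (pow R x k * pow R y (n ∸ k)))
  binomial n x y = begin
    pow R (x + y) n                                ≡⟨ pow≡^ (x + y) n ⟩
    (x + y) ^ n                                    ≈⟨ Binomial.theorem commutativeSemiring n x y ⟩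
    sum {suc n} (λ i → term (toℕ i))               ≈⟨ sum≈sumL n term ⟩
    sumL R n term                                  ≈⟨ sumL-cong n (λ k → trans (×≈embed* (n C k) _)
                                                        (*-congˡ (reflexive (≡.sym (≡.cong₂ _*_ (pow≡^ x k) (pow≡^ y (n ∸ k))))))) ⟩
    sumL R n (λ k → embed R (n C k) * (pow R x k * pow R y (n ∸ k))) ∎
    where
      term : ℕ → Carrier
      term k = (n C k) × (x ^ k * y ^ (n ∸ k))

  trinomial : ∀ n x y z →
    pow R (x + y + z) n ≈ sum3 R n (λ k l m → embed R (multinomial n k l m) * pow R x k * pow R y l * pow R z m)
  trinomial n x y z = begin
    pow R (x + y + z) n   ≈⟨ pow-cong n (+-assoc x y z) ⟩
    pow R (x + (y + z)) n ≈⟨ binomial n x (y + z) ⟩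
    sumL R n (λ k → embed R (n C k) * (pow R x k * pow R (y + z) (n ∸ k)))
      ≈⟨ sumL-cong n (λ k → *-congˡ (*-congˡ (binomial (n ∸ k) y z))) ⟩
    sumL R n (λ k → embed R (n C k) * (pow R x k * sumL R (n ∸ k) (λ l → innerTerm k l (n ∸ k ∸ l))))
      ≈⟨ sumL-cong n (λ k → trans (*-congˡ (sumL-*ˡ (n ∸ k) _ _)) (sumL-*ˡ (n ∸ k) _ _)) ⟩
    sum3 R n iteratedTerm ≈⟨ sum3-cong≤ n {iteratedTerm} {trinomialTerm} regroup ⟩
    sum3 R n trinomialTerm ∎
    where
      innerTerm iteratedTerm trinomialTerm : ℕ → ℕ → ℕ → Carrier
      innerTerm k l m = embed R ((n ∸ k) C l) * (pow R y l * pow R z m)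
      iteratedTerm k l m = embed R (n C k) * (pow R x k * innerTerm k l m)
      trinomialTerm k l m = embed R (multinomial n k l m) * pow R x k * pow R y l * pow R z m
      regroup : ∀ k l → k ≤ n → l ≤ n ∸ k → iteratedTerm k l (n ∸ k ∸ l) ≈ trinomialTerm k l (n ∸ k ∸ l)
      regroup k l k≤n l≤n-k = begin
        embed R (n C k) * (pow R x k * (embed R ((n ∸ k) C l) * (pow R y l * pow R z (n ∸ k ∸ l))))
          ≈⟨ solve 5 (λ A B X Y Z → (A ⊕ (X ⊕ (B ⊕ (Y ⊕ Z)))) ⊜ ((((A ⊕ B) ⊕ X) ⊕ Y) ⊕ Z)) refl _ _ _ _ _ ⟩
        embed R (n C k) * embed R ((n ∸ k) C l) * pow R x k * pow R y l * pow R z (n ∸ k ∸ l)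
          ≈⟨ *-congʳ (*-congʳ (*-congʳ (trans (sym (embed-* (n C k) ((n ∸ k) C l)))
               (reflexive (≡.cong (embed R) (≡.sym (multinomial≡binomials n k l k≤n l≤n-k))))))) ⟩
        trinomialTerm k l (n ∸ k ∸ l) ∎
        where open *-Solver using (solve; _⊕_; _⊜_)

  pow-+₃ : ∀ x A B C → pow R x A * pow R x B * pow R x C ≈ pow R x (A +ℕ B +ℕ C)
  pow-+₃ x A B C = sym (trans (pow-+ x (A +ℕ B) C) (*-congʳ (pow-+ x A B)))

  embed-+₃ : ∀ A B C → embed R A + embed R B + embed R C ≈ embed R (A +ℕ B +ℕ C)
  embed-+₃ A B C = sym (trans (embed-+ (A +ℕ B) C) (+-congʳ (embed-+ A B)))

  S≡sumL : ∀ k Q N → S R k Q N ≡ sumL R N (λ i → pow R (embed R i) k * pow R Q i)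
  S≡sumL k Q zero    = ≡.refl
  S≡sumL k Q (suc N) = ≡.cong (_+ pow R (embed R (suc N)) k * pow R Q (suc N)) (S≡sumL k Q N)

  weighted-S : ∀ w k Q N →
    pow R (embed R w) k * S R k Q N ≈ sumL R N (λ i → pow R (embed R (w *ℕ i)) k * pow R Q i)
  weighted-S w k Q N = begin
    pow R (embed R w) k * S R k Q N
      ≡⟨ ≡.cong (pow R (embed R w) k *_) (S≡sumL k Q N) ⟩
    pow R (embed R w) k * sumL R N (λ i → pow R (embed R i) k * pow R Q i)
      ≈⟨ sumL-*ˡ N _ _ ⟩
    sumL R N (λ i → pow R (embed R w) k * (pow R (embed R i) k * pow R Q i))
      ≈⟨ sumL-cong N (λ i → trans (sym (*-assoc _ _ _)) (*-congʳ (sym (weight i)))) ⟩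
    sumL R N (λ i → pow R (embed R (w *ℕ i)) k * pow R Q i) ∎
    where
      weight : ∀ i → pow R (embed R (w *ℕ i)) k ≈ pow R (embed R w) k * pow R (embed R i) k
      weight i = trans (pow-cong k (embed-* w i)) (pow-* _ _ k)

  wpow≈inverse*pow : ∀ w v k → embed R w * v ≈ 1# → wpow R w v k ≈ v * pow R (embed R w) k
  wpow≈inverse*pow w v zero    _    = sym (*-identityʳ v)
  wpow≈inverse*pow w v (suc k) wv≈1 = begin
    pow R (embed R w) k                   ≈⟨ *-identityˡ _ ⟨
    1# * pow R (embed R w) k              ≈⟨ *-congʳ wv≈1 ⟨
    (embed R w * v) * pow R (embed R w) k ≈⟨ *-congʳ (*-comm _ _) ⟩
    (v * embed R w) * pow R (embed R w) k ≈⟨ *-assoc _ _ _ ⟩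
    v * pow R (embed R w) (suc k)         ∎

  cyclicTerm : Carrier → (a b c : ℕ) (va vb vc : Carrier) → ℕ → ℕ → ℕ → ℕ → Carrier
  cyclicTerm q a b c va vb vc n k l m =
    embed R (multinomial n k l m) * S R k (pow R q c) (a ∸ 1) * S R l (pow R q a) (b ∸ 1)
    * S R m (pow R q b) (c ∸ 1) * wpow R c vc k * wpow R a va l * wpow R b vb m

  -- Σ_{i≤a', j≤b', h≤c'} f(c i + a j + b h)  where a = a'+1, b = b'+1, c = c'+1.
  latticeSum : ℕ → ℕ → ℕ → (ℕ → Carrier) → Carrier
  latticeSum a' b' c' f = boxSum a' b' c' (λ i j h → f (suc c' *ℕ i +ℕ suc a' *ℕ j +ℕ suc b' *ℕ h))

  -- The triangular sum of cyclic terms equals (abc)⁻¹ Σ q^N N^n over the lattice points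
  -- N = c i + a j + b h: expand the power sums, exchange the summations, and
  -- recognise the trinomial expansion of N^n = (c i + a j + b h)^n.
  powerSum-expansion : ∀ q a' b' c' va vb vc →
    embed R (suc a') * va ≈ 1# → embed R (suc b') * vb ≈ 1# → embed R (suc c') * vc ≈ 1# → ∀ n →
    sum3 R n (cyclicTerm q (suc a') (suc b') (suc c') va vb vc n)
      ≈ (vc * va * vb) * latticeSum a' b' c' (λ N → pow R q N * pow R (embed R N) n)
  powerSum-expansion q a' b' c' va vb vc ha hb hc n = begin
    sum3 R n (cyclicTerm q a b c va vb vc n)
      ≈⟨ sum3-cong n {G = λ k l m → V * productTerm k l m} factor ⟩
    sum3 R n (λ k l m → V * productTerm k l m)
      ≈⟨ sum3-*ˡ n V productTerm ⟨
    V * sum3 R n productTerm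
      ≈⟨ *-congˡ (sum3-cong n {productTerm} {λ k l m → boxSum a' b' c' (pointTerm k l m)} (λ k l m →
           trans (*-congˡ (boxSum-product a' b' c' (x k) (y l) (z m))) (boxSum-*ˡ a' b' c' _ _))) ⟩
    V * sum3 R n (λ k l m → boxSum a' b' c' (pointTerm k l m))
      ≈⟨ *-congˡ (sum3-boxSum-swap n a' b' c' pointTerm) ⟩
    V * boxSum a' b' c' (λ i j h → sum3 R n (λ k l m → pointTerm k l m i j h))
      ≈⟨ *-congˡ (boxSum-cong a' b' c' latticePoint) ⟩
    V * latticeSum a' b' c' f ∎
    where
      open *-Solver using (solve; _⊕_; _⊜_)
      a b c : ℕ
      a = suc a'
      b = suc b'
      c = suc c'
      V : Carrier
      V = vc * va * vb
      f : ℕ → Carrier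
      f N = pow R q N * pow R (embed R N) n
      M : ℕ → ℕ → ℕ → Carrier
      M k l m = embed R (multinomial n k l m)
      x : ℕ → ℕ → Carrier
      x k i = pow R (embed R (c *ℕ i)) k * pow R (pow R q c) i
      y : ℕ → ℕ → Carrier
      y l j = pow R (embed R (a *ℕ j)) l * pow R (pow R q a) j
      z : ℕ → ℕ → Carrier
      z m h = pow R (embed R (b *ℕ h)) m * pow R (pow R q b) h
      productTerm : ℕ → ℕ → ℕ → Carrier
      productTerm k l m = M k l m * (sumL R a' (x k) * sumL R b' (y l) * sumL R c' (z m))
      pointTerm : ℕ → ℕ → ℕ → ℕ → ℕ → ℕ → Carrier
      pointTerm k l m i j h = M k l m * (x k i * y l j * z m h)

      factor : ∀ k l m → cyclicTerm q a b c va vb vc n k l m ≈ V * productTerm k l m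
      factor k l m = begin
        M k l m * Sc * Sa * Sb * wpow R c vc k * wpow R a va l * wpow R b vb m
          ≈⟨ *-cong (*-cong (*-congˡ (wpow≈inverse*pow c vc k hc)) (wpow≈inverse*pow a va l ha))
                    (wpow≈inverse*pow b vb m hb) ⟩
        M k l m * Sc * Sa * Sb * (vc * pc) * (va * pa) * (vb * pb)
          ≈⟨ solve 10 (λ μ s₁ s₂ s₃ u₁ p₁ u₂ p₂ u₃ p₃ →
               ((((((μ ⊕ s₁) ⊕ s₂) ⊕ s₃) ⊕ (u₁ ⊕ p₁)) ⊕ (u₂ ⊕ p₂)) ⊕ (u₃ ⊕ p₃))
               ⊜ (((u₁ ⊕ u₂) ⊕ u₃) ⊕ (μ ⊕ (((p₁ ⊕ s₁) ⊕ (p₂ ⊕ s₂)) ⊕ (p₃ ⊕ s₃)))))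
               refl (M k l m) Sc Sa Sb vc pc va pa vb pb ⟩
        V * (M k l m * ((pc * Sc) * (pa * Sa) * (pb * Sb)))
          ≈⟨ *-congˡ (*-congˡ (*-cong (*-cong (weighted-S c k (pow R q c) a') (weighted-S a l (pow R q a) b'))
                                      (weighted-S b m (pow R q b) c'))) ⟩
        V * (M k l m * (sumL R a' (x k) * sumL R b' (y l) * sumL R c' (z m))) ∎
        where
          Sc Sa Sb pc pa pb : Carrier
          Sc = S R k (pow R q c) a'
          Sa = S R l (pow R q a) b'
          Sb = S R m (pow R q b) c'
          pc = pow R (embed R c) k
          pa = pow R (embed R a) l
          pb = pow R (embed R b) m

      latticePoint : ∀ i j h → sum3 R n (λ k l m → pointTerm k l m i j h) ≈ f (c *ℕ i +ℕ a *ℕ j +ℕ b *ℕ h)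
      latticePoint i j h = begin
        sum3 R n (λ k l m → pointTerm k l m i j h)
          ≈⟨ sum3-cong n {G = λ k l m → Q * trinomialTerm k l m} (λ k l m →
               solve 7 (λ μ X Qx Y Qy Z Qz → (μ ⊕ (((X ⊕ Qx) ⊕ (Y ⊕ Qy)) ⊕ (Z ⊕ Qz)))
                                              ⊜ (((Qx ⊕ Qy) ⊕ Qz) ⊕ (((μ ⊕ X) ⊕ Y) ⊕ Z)))
                     refl (M k l m) _ _ _ _ _ _) ⟩
        sum3 R n (λ k l m → Q * trinomialTerm k l m)
          ≈⟨ sum3-*ˡ n Q trinomialTerm ⟨
        Q * sum3 R n trinomialTerm
          ≈⟨ *-congˡ (trinomial n ci aj bh) ⟨
        Q * pow R (ci + aj + bh) n
          ≈⟨ *-cong Q≈ (pow-cong n (embed-+₃ (c *ℕ i) (a *ℕ j) (b *ℕ h))) ⟩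
        f (c *ℕ i +ℕ a *ℕ j +ℕ b *ℕ h) ∎
        where
          ci aj bh Q : Carrier
          ci = embed R (c *ℕ i)
          aj = embed R (a *ℕ j)
          bh = embed R (b *ℕ h)
          Q = pow R (pow R q c) i * pow R (pow R q a) j * pow R (pow R q b) h
          trinomialTerm : ℕ → ℕ → ℕ → Carrier
          trinomialTerm k l m = M k l m * pow R ci k * pow R aj l * pow R bh m
          Q≈ : Q ≈ pow R q (c *ℕ i +ℕ a *ℕ j +ℕ b *ℕ h)
          Q≈ = trans (*-cong (*-cong (pow-pow q c i) (pow-pow q a j)) (pow-pow q b h))
                     (pow-+₃ q (c *ℕ i) (a *ℕ j) (b *ℕ h))

  infix 4 _≐_
  _≐_ : (ℕ → Carrier) → (ℕ → Carrier) → Set ℓ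
  F ≐ G = ∀ N → F N ≈ G N

  ≐-sym : ∀ {F G} → F ≐ G → G ≐ F
  ≐-sym F≐G N = sym (F≐G N)

  ≐-trans : ∀ {F G H} → F ≐ G → G ≐ H → F ≐ H
  ≐-trans F≐G G≐H N = trans (F≐G N) (G≐H N)

  latticeSum-cong : ∀ a' b' c' {F G} → F ≐ G → latticeSum a' b' c' F ≈ latticeSum a' b' c' G
  latticeSum-cong a' b' c' F≐G = boxSum-cong a' b' c' (λ i j h → F≐G _)

  Δ : ℕ → (ℕ → Carrier) → ℕ → Carrier
  Δ d F N = F (N +ℕ d) - F N

  Δ-cong : ∀ d {F G} → F ≐ G → Δ d F ≐ Δ d G
  Δ-cong d F≐G N = +-cong (F≐G (N +ℕ d)) (-‿cong (F≐G N))

  -- Δ d depends on the step only through its value (used to reorder products of steps).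
  Δ-step≡ : ∀ {d e} → d ≡ e → ∀ F → Δ d F ≐ Δ e F
  Δ-step≡ ≡.refl F N = refl

  Δ-comm : ∀ d e F → Δ d (Δ e F) ≐ Δ e (Δ d F)
  Δ-comm d e F N = trans (sub-interchange _ _ _ _)
    (+-congʳ (+-congʳ (reflexive (≡.cong F (+-swapʳ N d e)))))

  progSum : ℕ → ℕ → (ℕ → Carrier) → ℕ → Carrier
  progSum d c' h M = sumL R c' (λ t → h (M +ℕ d *ℕ t))

  progSum-cong : ∀ d c' {F G} → F ≐ G → progSum d c' F ≐ progSum d c' G
  progSum-cong d c' F≐G M = sumL-cong c' (λ t → F≐G _)

  -- Summing a d-difference along a progression of step d telescopes.
  progSum-Δ : ∀ d c' F → progSum d c' (Δ d F) ≐ Δ (d *ℕ suc c') F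
  progSum-Δ d c' F M = begin
    sumL R c' (λ t → F (M +ℕ d *ℕ t +ℕ d) - F (M +ℕ d *ℕ t))
      ≈⟨ sumL-cong c' (λ t → +-congʳ (reflexive (≡.cong F (next t)))) ⟩
    sumL R c' (λ t → F (M +ℕ d *ℕ suc t) - F (M +ℕ d *ℕ t))
      ≈⟨ sumL-telescope c' (λ t → F (M +ℕ d *ℕ t)) ⟩
    F (M +ℕ d *ℕ suc c') - F (M +ℕ d *ℕ 0)
      ≡⟨ ≡.cong (λ u → F (M +ℕ d *ℕ suc c') - F u) (≡.trans (≡.cong (M +ℕ_) (ℕ.*-zeroʳ d)) (ℕ.+-identityʳ M)) ⟩
    F (M +ℕ d *ℕ suc c') - F M ∎
    where
      next : ∀ t → M +ℕ d *ℕ t +ℕ d ≡ M +ℕ d *ℕ suc t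
      next t = ≡.trans (ℕ.+-assoc M (d *ℕ t) d)
                       (≡.cong (M +ℕ_) (≡.trans (ℕ.+-comm (d *ℕ t) d) (≡.sym (ℕ.*-suc d t))))

  progSum-Δ-comm : ∀ d c' e F → progSum d c' (Δ e F) ≐ Δ e (progSum d c' F)
  progSum-Δ-comm d c' e F M = trans
    (sumL-cong c' (λ t → +-congʳ (reflexive (≡.cong F (+-swapʳ M (d *ℕ t) e)))))
    (sumL-- c' (λ t → F (M +ℕ e +ℕ d *ℕ t)) (λ t → F (M +ℕ d *ℕ t)))

  -- Every sequence g has a d-antidifference (d = d'+1):
  -- F N = Σ_{t < N/d} g (N mod d + t d), so that F (N + d) = F N + g N.
  sumBelow : ℕ → (ℕ → Carrier) → Carrier
  sumBelow zero    g = 0#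
  sumBelow (suc k) g = sumBelow k g + g k

  antidifference : ℕ → (ℕ → Carrier) → ℕ → Carrier
  antidifference d' g N = sumBelow (N / suc d') (λ t → g (N % suc d' +ℕ t *ℕ suc d'))

  Δ-antidifference : ∀ d' g → Δ (suc d') (antidifference d' g) ≐ g
  Δ-antidifference d' g N = begin
    sumBelow ((N +ℕ d) / d) (λ t → g ((N +ℕ d) % d +ℕ t *ℕ d)) - sumBelow (N / d) G
      ≡⟨ ≡.cong₂ (λ u v → sumBelow u (λ t → g (v +ℕ t *ℕ d)) - sumBelow (N / d) G)
                 ([m+n]/n≡1+m/n N d') ([m+n]%n≡m%n N d) ⟩
    (sumBelow (N / d) G + G (N / d)) - sumBelow (N / d) G ≈⟨ xyx⁻¹≈y _ _ ⟩
    G (N / d)                                               ≡⟨ ≡.cong g (≡.sym (m≡m%n+[m/n]*n N d)) ⟩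
    g N                                                     ∎
    where
      d : ℕ
      d = suc d'
      G : ℕ → Carrier
      G t = g (N % d +ℕ t *ℕ d)

  latticeSum-Δ : ∀ a' b' c' F → let a = suc a' ; b = suc b' ; c = suc c' in
    latticeSum a' b' c' (Δ b (Δ a (Δ c F))) ≈ Δ (b *ℕ c) (Δ (a *ℕ b) (Δ (c *ℕ a) F)) 0
  latticeSum-Δ a' b' c' F = ≐-trans (progSum-cong c a' inner) outer 0
    where
      a b c : ℕ
      a = suc a'
      b = suc b'
      c = suc c'
      inner : progSum a b' (progSum b c' (Δ b (Δ a (Δ c F)))) ≐ Δ (b *ℕ c) (Δ (a *ℕ b) (Δ c F))
      inner = ≐-trans (progSum-cong a b' (progSum-Δ b c' (Δ a (Δ c F))))
             (≐-trans (progSum-Δ-comm a b' (b *ℕ c) (Δ a (Δ c F)))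
                      (Δ-cong (b *ℕ c) (progSum-Δ a b' (Δ c F))))
      outer : progSum c a' (Δ (b *ℕ c) (Δ (a *ℕ b) (Δ c F))) ≐ Δ (b *ℕ c) (Δ (a *ℕ b) (Δ (c *ℕ a) F))
      outer = ≐-trans (progSum-Δ-comm c a' (b *ℕ c) (Δ (a *ℕ b) (Δ c F)))
             (Δ-cong (b *ℕ c) (≐-trans (progSum-Δ-comm c a' (a *ℕ b) (Δ c F))
                                       (Δ-cong (a *ℕ b) (progSum-Δ c a' F))))

  latticeSum-reciprocity : ∀ a' b' c' f → latticeSum a' b' c' f ≈ latticeSum a' c' b' f
  latticeSum-reciprocity a' b' c' f = begin
    latticeSum a' b' c' f                          ≈⟨ latticeSum-cong a' b' c' (≐-sym ΔbΔaΔcF≐f) ⟩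
    latticeSum a' b' c' (Δ b (Δ a (Δ c F)))        ≈⟨ latticeSum-Δ a' b' c' F ⟩
    Δ (b *ℕ c) (Δ (a *ℕ b) (Δ (c *ℕ a) F)) 0       ≈⟨ reorder 0 ⟩
    Δ (c *ℕ b) (Δ (a *ℕ c) (Δ (b *ℕ a) F)) 0       ≈⟨ latticeSum-Δ a' c' b' F ⟨
    latticeSum a' c' b' (Δ c (Δ a (Δ b F)))        ≈⟨ latticeSum-cong a' c' b' (≐-trans ΔcΔaΔbF≐ΔbΔaΔcF ΔbΔaΔcF≐f) ⟩
    latticeSum a' c' b' f                          ∎
    where
      a b c : ℕ
      a = suc a'
      b = suc b'
      c = suc c'
      F : ℕ → Carrier
      F = antidifference c' (antidifference a' (antidifference b' f))
      ΔbΔaΔcF≐f : Δ b (Δ a (Δ c F)) ≐ f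
      ΔbΔaΔcF≐f = ≐-trans (Δ-cong b (≐-trans (Δ-cong a (Δ-antidifference c' _)) (Δ-antidifference a' _)))
                          (Δ-antidifference b' f)
      ΔcΔaΔbF≐ΔbΔaΔcF : Δ c (Δ a (Δ b F)) ≐ Δ b (Δ a (Δ c F))
      ΔcΔaΔbF≐ΔbΔaΔcF = ≐-trans (Δ-cong c (Δ-comm a b F)) (≐-trans (Δ-comm c b _) (Δ-cong b (Δ-comm c a F)))
      reorder : Δ (b *ℕ c) (Δ (a *ℕ b) (Δ (c *ℕ a) F)) ≐ Δ (c *ℕ b) (Δ (a *ℕ c) (Δ (b *ℕ a) F))
      reorder = ≐-trans (Δ-cong (b *ℕ c) (Δ-comm (a *ℕ b) (c *ℕ a) F))
                (≐-trans (Δ-step≡ (ℕ.*-comm b c) _)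
                 (Δ-cong (c *ℕ b) (≐-trans (Δ-step≡ (ℕ.*-comm c a) _)
                                           (Δ-cong (a *ℕ c) (Δ-step≡ (ℕ.*-comm a b) F)))))

theorem4p17 : {c ℓ : Level} (R : CommutativeRing c ℓ) →
    let open CommutativeRing R in
    (q : Carrier) (w₁ w₂ w₃ : ℕ) → w₁ > 0 → w₂ > 0 → w₃ > 0 →
    (v₁ v₂ v₃ : Carrier) →
    embed R w₁ * v₁ ≈ 1# → embed R w₂ * v₂ ≈ 1# → embed R w₃ * v₃ ≈ 1# →
    (n : ℕ) →
    sum3 R n (λ k l m → embed R (multinomial n k l m)
        * S R k (pow R q w₃) (w₁ ∸ 1) * S R l (pow R q w₁) (w₂ ∸ 1) * S R m (pow R q w₂) (w₃ ∸ 1)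
        * wpow R w₃ v₃ k * wpow R w₁ v₁ l * wpow R w₂ v₂ m)
    ≈
    sum3 R n (λ k l m → embed R (multinomial n k l m)
        * S R k (pow R q w₂) (w₁ ∸ 1) * S R l (pow R q w₁) (w₃ ∸ 1) * S R m (pow R q w₃) (w₂ ∸ 1)
        * wpow R w₂ v₂ k * wpow R w₁ v₁ l * wpow R w₃ v₃ m)
-- (Zero weights are excluded by the hypotheses w > 0, so only positive weights occur.)
theorem4p17 R q (suc a') (suc b') (suc c') _ _ _ v₁ v₂ v₃ h₁ h₂ h₃ n = begin
  -- both sides are instances of cyclicTerm, with the roles of w₂ and w₃ exchanged
  sum3 R n (cyclicTerm R q (suc a') (suc b') (suc c') v₁ v₂ v₃ n)
    ≈⟨ powerSum-expansion R q a' b' c' v₁ v₂ v₃ h₁ h₂ h₃ n ⟩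
  (v₃ * v₁ * v₂) * latticeSum R a' b' c' f
    ≈⟨ *-cong (xy∙z≈zy∙x v₃ v₁ v₂) (latticeSum-reciprocity R a' b' c' f) ⟩
  (v₂ * v₁ * v₃) * latticeSum R a' c' b' f
    ≈⟨ powerSum-expansion R q a' c' b' v₁ v₃ v₂ h₁ h₃ h₂ n ⟨
  sum3 R n (cyclicTerm R q (suc a') (suc c') (suc b') v₁ v₃ v₂ n) ∎
  where
    open CommutativeRing R
    open SetoidReasoning setoid
    open CommutativeSemigroupProperties *-commutativeSemigroup using (xy∙z≈zy∙x)
    f : ℕ → Carrier
    f N = pow R q N * pow R (embed R N) n
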